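{- For every positive integer $n \equiv 3 \pmod 4$ and every odd integer $d$ with $1 \le d \le n-1$ and $d \ne \frac{n-1}{2}$, there exists an almost $d$-regular graph on $n$ vertices that does not contain a $5$-cycle as an induced subgraph.
   Context: A graph is almost $d$-regular if all vertices except one have degree $d$ and the remaining vertex has degree $d+1$ or $d-1$. -}

module Defs where

open import Data.Nat using (ℕ; suc; _+_; _∸_)
open import Data.Bool using (Bool; true; false)
open import Data.Fin using (Fin)
open import Data.Fin.Subset using (Subset; ∣_∣)
open import Data.Vec using (tabulate)
open import Data.Product using (_×_; ∃-syntax)
open import Data.Sum using (_⊎_)
open import Relation.Binary.PropositionalEquality using (_≡_; _≢_)
open import Relation.Nullary using (¬_)
open import Function.Definitions using (Injective)

record Graph (n : ℕ) : Set where
  field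
    adj   : Fin n → Fin n → Bool
    sym   : ∀ i j → adj i j ≡ adj j i
    irrefl : ∀ i → adj i i ≡ false
open Graph public

nbhd : ∀ {n} → Graph n → Fin n → Subset n
nbhd G v = tabulate (adj G v)

degree : ∀ {n} → Graph n → Fin n → ℕ
degree G v = ∣ nbhd G v ∣

-- (d ∸ 1 is truncated subtraction; the theorem only uses d ≥ 1.)
-- All vertices except one have degree d, the remaining one has degree d+1 or d-1.
AlmostRegular : ∀ {n} → ℕ → Graph n → Set
AlmostRegular d G =
  ∃[ v ] ((degree G v ≡ suc d ⊎ degree G v ≡ d ∸ 1)
          × (∀ u → u ≢ v → degree G u ≡ d))

C5adj : Fin 5 → Fin 5 → Bool
C5adj i j with Data.Fin.toℕ i | Data.Fin.toℕ j
... | a | b = isCycAdj a b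
  where
  isCycAdj : ℕ → ℕ → Bool
  isCycAdj 0 1 = true
  isCycAdj 1 2 = true
  isCycAdj 2 3 = true
  isCycAdj 3 4 = true
  isCycAdj 4 0 = true
  isCycAdj 1 0 = true
  isCycAdj 2 1 = true
  isCycAdj 3 2 = true
  isCycAdj 4 3 = true
  isCycAdj 0 4 = true
  isCycAdj _ _ = false

HasInducedC5 : ∀ {n} → Graph n → Set
HasInducedC5 {n} G =
  ∃[ f ] (Injective _≡_ _≡_ f × (∀ (i j : Fin 5) → adj G (f i) (f j) ≡ C5adj i j))

-- Write n = 2N + 1 and d = 2e + 1 ≠ N. If d < N, take K_{d+2} with a perfect matching removed
-- from all vertices but one (that vertex has degree d + 1, the others degree d) and add a disjoint
-- d-regular graph on the remaining 2N − d − 1 vertices: a bipartite circulant, or the complement of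
-- one. If d > N, apply this to the odd degree 2N − d < N and take the complement; the exceptional
-- vertex then has degree d − 1. Every piece is C5-free because C5 is not bipartite, is connected,
-- and is self-complementary: bipartite graphs are C5-free, and disjoint unions and complements
-- preserve C5-freeness.

module Submission where

open import Algebra.Properties.CommutativeSemigroup using (interchange)
open import Data.Bool using (Bool; true; false; not; _∧_; _xor_; T)
open import Data.Bool.Properties
  using (¬-not; not-involutive; not-injective; xor-same; xor-comm; ∧-identityʳ; ∧-zeroʳ)
import Data.Bool.Properties as Bool
open import Data.Empty using (⊥; ⊥-elim)
open import Data.Fin using (Fin; zero; suc; toℕ; fromℕ<)
open import Data.Fin.Properties using (all?; toℕ-fromℕ<; toℕ<n; toℕ-injective)
import Data.Fin.Properties as Fin
open import Data.Fin.Subset using (∣_∣)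
open import Data.Nat
open import Data.Nat.DivMod
open import Data.Nat.Properties
open import Data.Nat.Tactic.RingSolver using (solve-∀)
open import Data.Product using (Σ-syntax; ∃-syntax; _×_; _,_)
open import Data.Sum using (_⊎_; inj₁; inj₂)
import Data.Sum as Sum
open import Data.Unit using (tt)
open import Data.Vec using (tabulate)
open import Function using (_∘_)
open import Function.Definitions using (Injective)
open import Relation.Binary using (tri<; tri≈; tri>)
open import Relation.Binary.PropositionalEquality
open import Relation.Nullary using (¬_; ¬?; yes; no)
open import Relation.Nullary.Decidable using (toWitness; _→-dec_; dec-true; dec-false)

open import Defs using (Graph; C5adj; degree; AlmostRegular; HasInducedC5)

-- The 5-cycle

pattern 𝟘 = zero
pattern 𝟙 = suc zero
pattern 𝟚 = suc (suc zero)
pattern 𝟛 = suc (suc (suc zero))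
pattern 𝟜 = suc (suc (suc (suc zero)))

C5adj-irrefl : ∀ i → C5adj i i ≡ false
C5adj-irrefl = toWitness {a? = all? λ i → C5adj i i Bool.≟ false} _

-- Multiplication by 2 on ℤ/5ℤ; it maps the edges of C5 onto its non-edges.
double : Fin 5 → Fin 5
double 𝟘 = 𝟘
double 𝟙 = 𝟚
double 𝟚 = 𝟜
double 𝟛 = 𝟙
double 𝟜 = 𝟛

double-injective : Injective _≡_ _≡_ double
double-injective {i} {j} =
  toWitness {a? = all? λ i → all? λ j → (double i Fin.≟ double j) →-dec (i Fin.≟ j)} _ i j

C5adj-double : ∀ i j → i ≢ j → C5adj (double i) (double j) ≡ not (C5adj i j)
C5adj-double = toWitness {a? = all? λ i → all? λ j →
  ¬? (i Fin.≟ j) →-dec (C5adj (double i) (double j) Bool.≟ not (C5adj i j))} _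

C5-connected : (c : Fin 5 → Bool) → (∀ i j → C5adj i j ≡ true → c i ≡ c j) → ∀ i → c i ≡ c 𝟘
C5-connected c edge 𝟘 = refl
C5-connected c edge 𝟙 = edge 𝟙 𝟘 refl
C5-connected c edge 𝟚 = trans (edge 𝟚 𝟙 refl) (edge 𝟙 𝟘 refl)
C5-connected c edge 𝟛 = trans (edge 𝟛 𝟜 refl) (edge 𝟜 𝟘 refl)
C5-connected c edge 𝟜 = edge 𝟜 𝟘 refl

C5-not-bipartite : (c : Fin 5 → Bool) → ¬ (∀ i j → C5adj i j ≡ true → c i ≢ c j)
C5-not-bipartite c proper = proper 𝟘 𝟜 refl (begin
    c 𝟘                    ≡⟨ flips 𝟘 𝟙 refl ⟩
    not (c 𝟙)              ≡⟨ cong not (flips 𝟙 𝟚 refl) ⟩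
    not (not (c 𝟚))        ≡⟨ not-involutive _ ⟩
    c 𝟚                    ≡⟨ flips 𝟚 𝟛 refl ⟩
    not (c 𝟛)              ≡⟨ cong not (flips 𝟛 𝟜 refl) ⟩
    not (not (c 𝟜))        ≡⟨ not-involutive _ ⟩
    c 𝟜                    ∎)
  where
  open ≡-Reasoning
  flips : ∀ i j → C5adj i j ≡ true → c i ≡ not (c j)
  flips i j e = ¬-not (proper i j e)

-- Counting

bit : Bool → ℕ
bit true  = 1
bit false = 0

count : ℕ → (ℕ → Bool) → ℕ
count zero    p = 0
count (suc n) p = bit (p 0) + count n (p ∘ suc)

∣tabulate∣≡count : ∀ n (p : ℕ → Bool) → ∣ tabulate {n = n} (p ∘ toℕ) ∣ ≡ count n p
∣tabulate∣≡count zero    p = refl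
∣tabulate∣≡count (suc n) p with p 0
... | true  = cong suc (∣tabulate∣≡count n (p ∘ suc))
... | false = ∣tabulate∣≡count n (p ∘ suc)

count-cong : ∀ n {p q : ℕ → Bool} → (∀ j → j < n → p j ≡ q j) → count n p ≡ count n q
count-cong zero    p≡q = refl
count-cong (suc n) p≡q =
  cong₂ _+_ (cong bit (p≡q 0 z<s)) (count-cong n λ j j<n → p≡q (suc j) (s<s j<n))

count-false : ∀ n {p : ℕ → Bool} → (∀ j → j < n → p j ≡ false) → count n p ≡ 0
count-false zero    p≡false = refl
count-false (suc n) p≡false rewrite p≡false 0 z<s =
  count-false n λ j j<n → p≡false (suc j) (s<s j<n)

count-true : ∀ n → count n (λ _ → true) ≡ n
count-true zero    = refl
count-true (suc n) = cong suc (count-true n)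

count-+ : ∀ m n (p : ℕ → Bool) → count (m + n) p ≡ count m p + count n (p ∘ (m +_))
count-+ zero    n p = refl
count-+ (suc m) n p =
  trans (cong (bit (p 0) +_) (count-+ m n (p ∘ suc))) (sym (+-assoc (bit (p 0)) _ _))

count-additive : ∀ n {p q r : ℕ → Bool} → (∀ j → j < n → bit (p j) ≡ bit (q j) + bit (r j)) →
                 count n p ≡ count n q + count n r
count-additive zero    split = refl
count-additive (suc n) {p} {q} {r} split = begin
  bit (p 0) + count n (p ∘ suc)
    ≡⟨ cong₂ _+_ (split 0 z<s) (count-additive n λ j j<n → split (suc j) (s<s j<n)) ⟩
  (bit (q 0) + bit (r 0)) + (count n (q ∘ suc) + count n (r ∘ suc))
    ≡⟨ interchange +-commutativeSemigroup (bit (q 0)) (bit (r 0)) _ _ ⟩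
  (bit (q 0) + count n (q ∘ suc)) + (bit (r 0) + count n (r ∘ suc))
    ∎
  where open ≡-Reasoning

count-≡ᵇ : ∀ {n v} → v < n → count n (v ≡ᵇ_) ≡ 1
count-≡ᵇ {suc n} {zero}  _         = cong suc (count-false n λ _ _ → refl)
count-≡ᵇ {suc n} {suc v} (s<s v<n) = count-≡ᵇ v<n

count-<ᵇ : ∀ {n e} → e ≤ n → count n (_<ᵇ e) ≡ e
count-<ᵇ {n}     {zero}  _         = count-false n λ _ _ → refl
count-<ᵇ {suc n} {suc e} (s≤s e≤n) = cong suc (count-<ᵇ e≤n)

-- Rotating the range [0, K) by c splits it into [c, K) followed by [0, c).
count-rotate : ∀ K .{{_ : NonZero K}} {c} (p : ℕ → Bool) → c ≤ K →
               count K (λ j → p ((c + j) % K)) ≡ count K p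
count-rotate K {c} p c≤K = begin
  count K (p ∘ shifted)
    ≡⟨ cong (λ m → count m (p ∘ shifted)) (sym (m∸n+n≡m c≤K)) ⟩
  count (K ∸ c + c) (p ∘ shifted)
    ≡⟨ count-+ (K ∸ c) c _ ⟩
  count (K ∸ c) (p ∘ shifted) + count c (p ∘ shifted ∘ (K ∸ c +_))
    ≡⟨ cong₂ _+_ (count-cong (K ∸ c) (λ j → cong p ∘ no-wrap j)) (count-cong c (λ j → cong p ∘ wrap j)) ⟩
  count (K ∸ c) (p ∘ (c +_)) + count c p
    ≡⟨ +-comm _ (count c p) ⟩
  count c p + count (K ∸ c) (p ∘ (c +_))
    ≡⟨ count-+ c (K ∸ c) p ⟨
  count (c + (K ∸ c)) p
    ≡⟨ cong (λ m → count m p) (m+[n∸m]≡n c≤K) ⟩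
  count K p
    ∎
  where
  open ≡-Reasoning
  shifted : ℕ → ℕ
  shifted j = (c + j) % K
  no-wrap : ∀ j → j < K ∸ c → shifted j ≡ c + j
  no-wrap j j<K∸c = m<n⇒m%n≡m (subst (c + j <_) (m+[n∸m]≡n c≤K) (+-monoʳ-< c j<K∸c))
  wrap : ∀ j → j < c → shifted (K ∸ c + j) ≡ j
  wrap j j<c = begin
    (c + (K ∸ c + j)) % K   ≡⟨ cong (_% K) (sym (+-assoc c (K ∸ c) j)) ⟩
    (c + (K ∸ c) + j) % K   ≡⟨ cong (λ m → (m + j) % K) (m+[n∸m]≡n c≤K) ⟩
    (K + j) % K             ≡⟨ cong (_% K) (+-comm K j) ⟩
    (j + K) % K             ≡⟨ [m+n]%n≡m%n j K ⟩
    j % K                   ≡⟨ m<n⇒m%n≡m (<-≤-trans j<c c≤K) ⟩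
    j                       ∎

count-shift : ∀ K .{{_ : NonZero K}} u (p : ℕ → Bool) →
              count K (λ j → p ((u + j) % K)) ≡ count K p
count-shift K u p = trans (count-cong K reduce) (count-rotate K p (<⇒≤ (m%n<n u K)))
  where
  reduce : ∀ j → j < K → p ((u + j) % K) ≡ p ((u % K + j) % K)
  reduce j j<K = cong p (begin
    (u + j) % K             ≡⟨ %-distribˡ-+ u j K ⟩
    (u % K + j % K) % K     ≡⟨ cong (λ m → (u % K + m) % K) (m<n⇒m%n≡m j<K) ⟩
    (u % K + j) % K         ∎)
    where open ≡-Reasoning

<ᵇ-true : ∀ {m n} → m < n → (m <ᵇ n) ≡ true
<ᵇ-true {m} {n} = dec-true (m <? n)

<ᵇ-false : ∀ {m n} → n ≤ m → (m <ᵇ n) ≡ false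
<ᵇ-false {m} {n} n≤m = dec-false (m <? n) (≤⇒≯ n≤m)

<ᵇ-true⁻¹ : ∀ {m n} → (m <ᵇ n) ≡ true → m < n
<ᵇ-true⁻¹ {m} {n} eq = <ᵇ⇒< m n (subst T (sym eq) tt)

<ᵇ-false⁻¹ : ∀ {m n} → (m <ᵇ n) ≡ false → n ≤ m
<ᵇ-false⁻¹ eq = ≮⇒≥ λ m<n → subst T eq (<⇒<ᵇ m<n)

≡ᵇ-false : ∀ {m n} → m ≢ n → (m ≡ᵇ n) ≡ false
≡ᵇ-false {m} {n} = dec-false (m ≟ n)

≡ᵇ-refl : ∀ m → (m ≡ᵇ m) ≡ true
≡ᵇ-refl m = dec-true (m ≟ m) refl

≡ᵇ-sym : ∀ m n → (m ≡ᵇ n) ≡ (n ≡ᵇ m)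
≡ᵇ-sym zero    zero    = refl
≡ᵇ-sym zero    (suc n) = refl
≡ᵇ-sym (suc m) zero    = refl
≡ᵇ-sym (suc m) (suc n) = ≡ᵇ-sym m n

-- Graphs on an initial segment of ℕ

-- Vertices are the naturals below size; adjacency outside that range is irrelevant.
record ℕGraph : Set where
  field
    size       : ℕ
    adj        : ℕ → ℕ → Bool
    adj-sym    : ∀ i j → adj i j ≡ adj j i
    adj-irrefl : ∀ i → adj i i ≡ false
open ℕGraph

deg : ℕGraph → ℕ → ℕ
deg G v = count (size G) (adj G v)

Regular : ℕ → ℕGraph → Set
Regular d G = ∀ v → v < size G → deg G v ≡ d

RegularExcept : ℕ → ℕ → ℕGraph → Set
RegularExcept d x G = ∀ v → v < size G → v ≢ x → deg G v ≡ d

record InducedC5 (G : ℕGraph) : Set where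
  field
    embed     : Fin 5 → ℕ
    embed-<   : ∀ i → embed i < size G
    embed-inj : Injective _≡_ _≡_ embed
    embed-adj : ∀ i j → adj G (embed i) (embed j) ≡ C5adj i j
open InducedC5

C5Free : ℕGraph → Set
C5Free G = ¬ InducedC5 G

bipartite⇒C5Free : ∀ G (colour : ℕ → Bool) →
                   (∀ x y → adj G x y ≡ true → colour x ≢ colour y) → C5Free G
bipartite⇒C5Free G colour proper C =
  C5-not-bipartite (colour ∘ embed C) λ i j e → proper _ _ (trans (embed-adj C i j) e)

K₁ : ℕGraph
K₁ = record { size = 1 ; adj = λ _ _ → false ; adj-sym = λ _ _ → refl ; adj-irrefl = λ _ → refl }

K₁-C5Free : C5Free K₁
K₁-C5Free = bipartite⇒C5Free K₁ (λ _ → true) λ _ _ ()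

K₁-RegularExcept : ∀ d → RegularExcept d 0 K₁
K₁-RegularExcept d zero z<s 0≢0 = ⊥-elim (0≢0 refl)

complement : ℕGraph → ℕGraph
complement G = record
  { size       = size G
  ; adj        = λ i j → not (adj G i j) ∧ not (i ≡ᵇ j)
  ; adj-sym    = λ i j → cong₂ (λ a e → not a ∧ not e) (adj-sym G i j) (≡ᵇ-sym i j)
  ; adj-irrefl = λ i → trans (cong (λ e → not (adj G i i) ∧ not e) (≡ᵇ-refl i)) (∧-zeroʳ _)
  }

complement-adj : ∀ G {i j} → i ≢ j → adj (complement G) i j ≡ not (adj G i j)
complement-adj G {i} {j} i≢j =
  trans (cong (λ e → not (adj G i j) ∧ not e) (≡ᵇ-false i≢j)) (∧-identityʳ _)

deg-complement : ∀ G {v} → v < size G → deg G v + deg (complement G) v + 1 ≡ size G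
deg-complement G {v} v<n = begin
  count n (adj G v) + count n (adj (complement G) v) + 1
    ≡⟨ cong₂ _+_ (count-additive n edge-or-non-edge) (count-≡ᵇ v<n) ⟨
  count n (λ j → not (v ≡ᵇ j)) + count n (v ≡ᵇ_)
    ≡⟨ count-additive n self-or-other ⟨
  count n (λ _ → true)
    ≡⟨ count-true n ⟩
  n ∎
  where
  open ≡-Reasoning
  n = size G
  self-or-other : ∀ j → j < n → 1 ≡ bit (not (v ≡ᵇ j)) + bit (v ≡ᵇ j)
  self-or-other j _ with v ≡ᵇ j
  ... | true  = refl
  ... | false = refl
  edge-or-non-edge : ∀ j → j < n → bit (not (v ≡ᵇ j)) ≡ bit (adj G v j) + bit (adj (complement G) v j)
  edge-or-non-edge j _ with v ≟ j
  ... | yes refl rewrite ≡ᵇ-refl v | adj-irrefl G v = refl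
  ... | no v≢j rewrite complement-adj G v≢j | ≡ᵇ-false v≢j with adj G v j
  ...   | true  = refl
  ...   | false = refl

deg-complement-≡ : ∀ G {v d} → v < size G → deg G v + d + 1 ≡ size G → deg (complement G) v ≡ d
deg-complement-≡ G {v} v<n eq =
  +-cancelˡ-≡ (deg G v) _ _ (+-cancelʳ-≡ 1 _ _ (trans (deg-complement G v<n) (sym eq)))

complement-Regular : ∀ G {d d̄} → d + d̄ + 1 ≡ size G → Regular d G → Regular d̄ (complement G)
complement-Regular G eq reg v v<n =
  deg-complement-≡ G v<n (trans (cong (λ k → k + _ + 1) (reg v v<n)) eq)

complement-RegularExcept : ∀ G {d d̄ x} → d + d̄ + 1 ≡ size G →
                           RegularExcept d x G → RegularExcept d̄ x (complement G)
complement-RegularExcept G eq reg v v<n v≢x =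
  deg-complement-≡ G v<n (trans (cong (λ k → k + _ + 1) (reg v v<n v≢x)) eq)

complement-C5Free : ∀ G → C5Free G → C5Free (complement G)
complement-C5Free G free C = free record
  { embed     = embed C ∘ double
  ; embed-<   = embed-< C ∘ double
  ; embed-inj = double-injective ∘ embed-inj C
  ; embed-adj = adj-double
  }
  where
  adj-double : ∀ i j → adj G (embed C (double i)) (embed C (double j)) ≡ C5adj i j
  adj-double i j with i Fin.≟ j
  ... | yes refl = trans (adj-irrefl G _) (sym (C5adj-irrefl i))
  ... | no i≢j   = not-injective (begin
    not (adj G (embed C (double i)) (embed C (double j)))
      ≡⟨ complement-adj G (i≢j ∘ double-injective ∘ embed-inj C) ⟨
    adj (complement G) (embed C (double i)) (embed C (double j))
      ≡⟨ embed-adj C (double i) (double j) ⟩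
    C5adj (double i) (double j)
      ≡⟨ C5adj-double i j i≢j ⟩
    not (C5adj i j) ∎)
    where open ≡-Reasoning

⊕-adj : ℕGraph → ℕGraph → ℕ → ℕ → Bool
⊕-adj G H i j with i <ᵇ size G | j <ᵇ size G
... | true  | true  = adj G i j
... | false | false = adj H (i ∸ size G) (j ∸ size G)
... | _     | _     = false

_⊕_ : ℕGraph → ℕGraph → ℕGraph
G ⊕ H = record
  { size       = size G + size H
  ; adj        = ⊕-adj G H
  ; adj-sym    = sym′
  ; adj-irrefl = irrefl
  }
  where
  sym′ : ∀ i j → ⊕-adj G H i j ≡ ⊕-adj G H j i
  sym′ i j with i <ᵇ size G | j <ᵇ size G
  ... | true  | true  = adj-sym G i j
  ... | false | false = adj-sym H _ _
  ... | true  | false = refl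
  ... | false | true  = refl
  irrefl : ∀ i → ⊕-adj G H i i ≡ false
  irrefl i with i <ᵇ size G
  ... | true  = adj-irrefl G i
  ... | false = adj-irrefl H _

⊕-adj-inl : ∀ G H {i j} → i < size G → j < size G → adj (G ⊕ H) i j ≡ adj G i j
⊕-adj-inl G H i<m j<m rewrite <ᵇ-true i<m | <ᵇ-true j<m = refl

⊕-adj-inr : ∀ G H i j → adj (G ⊕ H) (size G + i) (size G + j) ≡ adj H i j
⊕-adj-inr G H i j
  rewrite <ᵇ-false {size G + i} (m≤m+n (size G) i) | <ᵇ-false {size G + j} (m≤m+n (size G) j)
        | m+n∸m≡n (size G) i | m+n∸m≡n (size G) j = refl

⊕-adj-across : ∀ G H {i j} → i < size G → size G ≤ j → adj (G ⊕ H) i j ≡ false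
⊕-adj-across G H i<m m≤j rewrite <ᵇ-true i<m | <ᵇ-false m≤j = refl

⊕-adj-sameSide : ∀ G H {i j} → adj (G ⊕ H) i j ≡ true → (i <ᵇ size G) ≡ (j <ᵇ size G)
⊕-adj-sameSide G H {i} {j} e with i <ᵇ size G | j <ᵇ size G
... | true  | true  = refl
... | false | false = refl

deg-⊕ˡ : ∀ G H {v} → v < size G → deg (G ⊕ H) v ≡ deg G v
deg-⊕ˡ G H {v} v<m = begin
  count (size G + size H) (adj (G ⊕ H) v)
    ≡⟨ count-+ (size G) (size H) _ ⟩
  count (size G) (adj (G ⊕ H) v) + count (size H) (adj (G ⊕ H) v ∘ (size G +_))
    ≡⟨ cong₂ _+_ (count-cong (size G) λ j j<m → ⊕-adj-inl G H v<m j<m)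
                 (count-false (size H) λ j _ → ⊕-adj-across G H v<m (m≤m+n (size G) j)) ⟩
  deg G v + 0
    ≡⟨ +-identityʳ _ ⟩
  deg G v ∎
  where open ≡-Reasoning

deg-⊕ʳ : ∀ G H v → deg (G ⊕ H) (size G + v) ≡ deg H v
deg-⊕ʳ G H v = begin
  count (size G + size H) (adj (G ⊕ H) (size G + v))
    ≡⟨ count-+ (size G) (size H) _ ⟩
  count (size G) (adj (G ⊕ H) (size G + v)) + count (size H) (adj (G ⊕ H) (size G + v) ∘ (size G +_))
    ≡⟨ cong₂ _+_ (count-false (size G) λ j j<m → across j<m)
                 (count-cong (size H) λ j _ → ⊕-adj-inr G H v j) ⟩
  deg H v ∎
  where
  open ≡-Reasoning
  across : ∀ {j} → j < size G → adj (G ⊕ H) (size G + v) j ≡ false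
  across j<m = trans (adj-sym (G ⊕ H) _ _) (⊕-adj-across G H j<m (m≤m+n (size G) v))

⊕-RegularExcept : ∀ G H {d x} → RegularExcept d x G → Regular d H → RegularExcept d x (G ⊕ H)
⊕-RegularExcept G H regG regH v v<m+n v≢x with v <? size G
... | yes v<m = trans (deg-⊕ˡ G H v<m) (regG v v<m v≢x)
... | no v≮m with u , refl ← m≤n⇒∃[o]m+o≡n (≮⇒≥ v≮m) =
  trans (deg-⊕ʳ G H u) (regH u (+-cancelˡ-< (size G) u (size H) v<m+n))

⊕-InducedC5ˡ : ∀ G H (C : InducedC5 (G ⊕ H)) → (∀ i → embed C i < size G) → InducedC5 G
⊕-InducedC5ˡ G H C inl = record
  { embed     = embed C
  ; embed-<   = inl
  ; embed-inj = embed-inj C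
  ; embed-adj = λ i j → trans (sym (⊕-adj-inl G H (inl i) (inl j))) (embed-adj C i j)
  }

⊕-InducedC5ʳ : ∀ G H (C : InducedC5 (G ⊕ H)) → (∀ i → size G ≤ embed C i) → InducedC5 H
⊕-InducedC5ʳ G H C inr = record
  { embed     = λ i → embed C i ∸ size G
  ; embed-<   = λ i → +-cancelˡ-< (size G) _ (size H) (subst (_< size G + size H) (sym (shift i)) (embed-< C i))
  ; embed-inj = λ e → embed-inj C (trans (sym (shift _)) (trans (cong (size G +_) e) (shift _)))
  ; embed-adj = λ i j → trans (sym (⊕-adj-inr G H _ _))
                              (trans (cong₂ (adj (G ⊕ H)) (shift i) (shift j)) (embed-adj C i j))
  }
  where
  shift : ∀ i → size G + (embed C i ∸ size G) ≡ embed C i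
  shift i = m+[n∸m]≡n (inr i)

⊕-C5Free : ∀ G H → C5Free G → C5Free H → C5Free (G ⊕ H)
⊕-C5Free G H freeG freeH C = onSide _ refl
  where
  sameSide : ∀ i → (embed C i <ᵇ size G) ≡ (embed C 𝟘 <ᵇ size G)
  sameSide = C5-connected _ λ i j e → ⊕-adj-sameSide G H (trans (embed-adj C i j) e)
  onSide : ∀ b → (embed C 𝟘 <ᵇ size G) ≡ b → ⊥
  onSide true  side₀ = freeG (⊕-InducedC5ˡ G H C λ i → <ᵇ-true⁻¹ (trans (sameSide i) side₀))
  onSide false side₀ = freeH (⊕-InducedC5ʳ G H C λ i → <ᵇ-false⁻¹ (trans (sameSide i) side₀))

-- Regular C5-free graphs

bipartiteCirculant : (K : ℕ) .{{_ : NonZero K}} → ℕ → ℕGraph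
bipartiteCirculant K c = record
  { size       = K + K
  ; adj        = λ x y → ((x <ᵇ K) xor (y <ᵇ K)) ∧ ((x + y) % K <ᵇ c)
  ; adj-sym    = λ x y → cong₂ _∧_ (xor-comm (x <ᵇ K) (y <ᵇ K))
                                   (cong (λ m → m % K <ᵇ c) (+-comm x y))
  ; adj-irrefl = λ x → cong (_∧ ((x + x) % K <ᵇ c)) (xor-same (x <ᵇ K))
  }

bipartiteCirculant-C5Free : ∀ K .{{_ : NonZero K}} c → C5Free (bipartiteCirculant K c)
bipartiteCirculant-C5Free K c = bipartite⇒C5Free (bipartiteCirculant K c) (_<ᵇ K) proper
  where
  proper : ∀ x y → adj (bipartiteCirculant K c) x y ≡ true → (x <ᵇ K) ≢ (y <ᵇ K)
  proper x y x~y same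
    with () ← trans (sym x~y) (trans (cong (λ b → (b xor (y <ᵇ K)) ∧ ((x + y) % K <ᵇ c)) same)
                                     (cong (_∧ ((x + y) % K <ᵇ c)) (xor-same (y <ᵇ K))))

count-residues-< : ∀ K .{{_ : NonZero K}} u {c} → c ≤ K →
                   count K (λ j → (u + j) % K <ᵇ c) ≡ c
count-residues-< K u c≤K = trans (count-shift K u _) (count-<ᵇ c≤K)

bipartiteCirculant-Regular : ∀ K .{{_ : NonZero K}} {c} → c ≤ K →
                             Regular c (bipartiteCirculant K c)
bipartiteCirculant-Regular K {c} c≤K v _ with v <? K
... | yes v<K = begin
  count (K + K) (adj B v)
    ≡⟨ count-+ K K _ ⟩
  count K (adj B v) + count K (adj B v ∘ (K +_))
    ≡⟨ cong₂ _+_ (count-false K λ j j<K → sameSide (<ᵇ-true j<K)) (count-cong K λ j _ → across j) ⟩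
  count K (λ j → (v + K + j) % K <ᵇ c)
    ≡⟨ count-residues-< K (v + K) c≤K ⟩
  c ∎
  where
  open ≡-Reasoning
  B = bipartiteCirculant K c
  sameSide : ∀ {j} → (j <ᵇ K) ≡ true → adj B v j ≡ false
  sameSide j<K rewrite <ᵇ-true v<K | j<K = refl
  across : ∀ j → adj B v (K + j) ≡ ((v + K + j) % K <ᵇ c)
  across j rewrite <ᵇ-true v<K | <ᵇ-false {K + j} (m≤m+n K j) | +-assoc v K j = refl
... | no v≮K = begin
  count (K + K) (adj B v)
    ≡⟨ count-+ K K _ ⟩
  count K (adj B v) + count K (adj B v ∘ (K +_))
    ≡⟨ cong₂ _+_ (count-cong K λ j j<K → across (<ᵇ-true j<K))
                 (count-false K λ j _ → sameSide (<ᵇ-false (m≤m+n K j))) ⟩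
  count K (λ j → (v + j) % K <ᵇ c) + 0
    ≡⟨ +-identityʳ _ ⟩
  count K (λ j → (v + j) % K <ᵇ c)
    ≡⟨ count-residues-< K v c≤K ⟩
  c ∎
  where
  open ≡-Reasoning
  B = bipartiteCirculant K c
  sameSide : ∀ {j} → (j <ᵇ K) ≡ false → adj B v j ≡ false
  sameSide j≥K rewrite <ᵇ-false (≮⇒≥ v≮K) | j≥K = refl
  across : ∀ {j} → (j <ᵇ K) ≡ true → adj B v j ≡ ((v + j) % K <ᵇ c)
  across j<K rewrite <ᵇ-false (≮⇒≥ v≮K) | j<K = refl

regularC5Free : ∀ K .{{_ : NonZero K}} {d} → d < K + K →
                Σ[ G ∈ ℕGraph ] size G ≡ K + K × C5Free G × Regular d G
regularC5Free K {d} d<2K with d ≤? K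
... | yes d≤K = bipartiteCirculant K d , refl , bipartiteCirculant-C5Free K d , bipartiteCirculant-Regular K d≤K
... | no d≰K with c , d+1+c≡2K ← m≤n⇒∃[o]m+o≡n d<2K =
  complement B , refl , complement-C5Free B (bipartiteCirculant-C5Free K c) ,
  complement-Regular B (trans (+-comm (c + d) 1) (trans (cong suc (+-comm c d)) d+1+c≡2K))
                       (bipartiteCirculant-Regular K (<⇒≤ c<K))
  where
  B = bipartiteCirculant K c
  c<K : c < K
  c<K = +-cancelˡ-< K c K (begin-strict
    K + c       <⟨ +-monoˡ-< c (≰⇒> d≰K) ⟩
    d + c       <⟨ n<1+n _ ⟩
    suc d + c   ≡⟨ d+1+c≡2K ⟩
    K + K       ∎)
    where open ≤-Reasoning

matching : ℕ → ℕGraph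
matching e = bipartiteCirculant (suc e) 1

completeMinusMatching : ℕ → ℕGraph
completeMinusMatching e = complement (K₁ ⊕ matching e)

completeMinusMatching-C5Free : ∀ e → C5Free (completeMinusMatching e)
completeMinusMatching-C5Free e =
  complement-C5Free (K₁ ⊕ matching e)
    (⊕-C5Free K₁ (matching e) K₁-C5Free (bipartiteCirculant-C5Free (suc e) 1))

completeMinusMatching-RegularExcept : ∀ e → RegularExcept (suc (2 * e)) 0 (completeMinusMatching e)
completeMinusMatching-RegularExcept e =
  complement-RegularExcept (K₁ ⊕ matching e) (size-eq e)
    (⊕-RegularExcept K₁ (matching e) (K₁-RegularExcept 1)
      (bipartiteCirculant-Regular (suc e) (s≤s z≤n)))
  where
  size-eq : ∀ e → 1 + suc (2 * e) + 1 ≡ 1 + (suc e + suc e)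
  size-eq = solve-∀

deg-completeMinusMatching-0 : ∀ e → deg (completeMinusMatching e) 0 ≡ suc (suc (2 * e))
deg-completeMinusMatching-0 e = deg-complement-≡ (K₁ ⊕ matching e) z<s
  (trans (cong (λ k → k + suc (suc (2 * e)) + 1) (deg-⊕ˡ K₁ (matching e) z<s)) (size-eq e))
  where
  size-eq : ∀ e → 0 + suc (suc (2 * e)) + 1 ≡ 1 + (suc e + suc e)
  size-eq = solve-∀

NearlyRegularC5Free : ℕ → ℕ → ℕ → Set
NearlyRegularC5Free n d d₀ =
  Σ[ G ∈ ℕGraph ] size G ≡ n × C5Free G × deg G 0 ≡ d₀ × RegularExcept d 0 G

nearlyRegular-below : ∀ {N e} → suc (2 * e) < N →
                      NearlyRegularC5Free (suc (N + N)) (suc (2 * e)) (suc (suc (2 * e)))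
nearlyRegular-below {e = e} d<N with t , refl ← m≤n⇒∃[o]m+o≡n d<N =
  let Q , size≡ , free , reg = regularC5Free (suc (e + t)) (d<2K e t) in
  completeMinusMatching e ⊕ Q ,
  trans (cong (size (completeMinusMatching e) +_) size≡) (size-eq e t) ,
  ⊕-C5Free (completeMinusMatching e) Q (completeMinusMatching-C5Free e) free ,
  trans (deg-⊕ˡ (completeMinusMatching e) Q z<s) (deg-completeMinusMatching-0 e) ,
  ⊕-RegularExcept (completeMinusMatching e) Q (completeMinusMatching-RegularExcept e) reg
  where
  halves : ∀ e t → suc (suc (2 * e)) + (t + t) ≡ suc (e + t) + suc (e + t)
  halves = solve-∀
  d<2K : ∀ e t → suc (2 * e) < suc (e + t) + suc (e + t)
  d<2K e t = subst (suc (2 * e) <_) (halves e t) (m≤m+n (suc (suc (2 * e))) (t + t))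
  size-eq : ∀ e t → 1 + (suc e + suc e) + (suc (e + t) + suc (e + t))
                  ≡ suc ((suc (suc (2 * e)) + t) + (suc (suc (2 * e)) + t))
  size-eq = solve-∀

2*≡+ : ∀ m → 2 * m ≡ m + m
2*≡+ m = cong (m +_) (+-identityʳ m)

1+2m≤n+n⇒m<n : ∀ {m n} → suc (2 * m) ≤ n + n → m < n
1+2m≤n+n⇒m<n {m} {n} le =
  ≰⇒> λ n≤m → <⇒≱ (subst (_≤ n + n) (cong suc (2*≡+ m)) le) (+-mono-≤ n≤m n≤m)

complementOdd : ∀ {N e} → N < suc (2 * e) → suc (2 * e) ≤ N + N →
                ∃[ r ] suc (2 * r) < N × suc (2 * e) + suc (2 * r) ≡ N + N
complementOdd {N} {e} N<d d≤2N with r , refl ← m≤n⇒∃[o]m+o≡n (1+2m≤n+n⇒m<n {e} {N} d≤2N) =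
  r , d̄<N , sum-eq e r
  where
  r<e : r < e
  r<e = +-cancelˡ-< e r e (subst (e + r <_) (2*≡+ e) (≤-pred N<d))
  d̄<N : suc (2 * r) < suc e + r
  d̄<N = s≤s (subst (_≤ e + r) (cong suc (sym (2*≡+ r))) (+-monoˡ-≤ r r<e))
  sum-eq : ∀ e r → suc (2 * e) + suc (2 * r) ≡ (suc e + r) + (suc e + r)
  sum-eq = solve-∀

nearlyRegular-above : ∀ {N e} → N < suc (2 * e) → suc (2 * e) ≤ N + N →
                      NearlyRegularC5Free (suc (N + N)) (suc (2 * e)) (2 * e)
nearlyRegular-above {N} {e} N<d d≤2N with r , d̄<N , d+d̄≡2N ← complementOdd {N} {e} N<d d≤2N =
  let G , size≡ , free , deg₀ , reg = nearlyRegular-below {N} {r} d̄<N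
      total : suc (2 * e) + suc (2 * r) + 1 ≡ size G
      total = trans (+-comm _ 1) (trans (cong suc d+d̄≡2N) (sym size≡))
  in
  complement G , size≡ , complement-C5Free G free ,
  deg-complement-≡ G (subst (0 <_) (sym size≡) z<s)
    (trans (cong (λ k → k + 2 * e + 1) deg₀) (trans (rearrange e r) total)) ,
  complement-RegularExcept G (trans (cong (_+ 1) (+-comm (suc (2 * r)) _)) total) reg
  where
  rearrange : ∀ e r → suc (suc (2 * r)) + 2 * e + 1 ≡ suc (2 * e) + suc (2 * r) + 1
  rearrange = solve-∀

AlmostRegularC5Free : ℕ → ℕ → Set
AlmostRegularC5Free n d = ∃[ G ] (AlmostRegular {n} d G × ¬ HasInducedC5 G)

toGraph : ∀ G {d x} → C5Free G → x < size G → (deg G x ≡ suc d ⊎ deg G x ≡ d ∸ 1) →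
          RegularExcept d x G → AlmostRegularC5Free (size G) d
toGraph G {d} {x} free x<n exceptional regular = H , (fromℕ< x<n , exceptional′ , regular′) , noC5
  where
  H : Graph (size G)
  H = record
    { adj = λ i j → adj G (toℕ i) (toℕ j) ; sym = λ i j → adj-sym G _ _ ; irrefl = λ i → adj-irrefl G _ }
  degree≡deg : ∀ v → degree H v ≡ deg G (toℕ v)
  degree≡deg v = ∣tabulate∣≡count (size G) (adj G (toℕ v))
  degree-x : degree H (fromℕ< x<n) ≡ deg G x
  degree-x = trans (degree≡deg _) (cong (deg G) (toℕ-fromℕ< x<n))
  exceptional′ : degree H (fromℕ< x<n) ≡ suc d ⊎ degree H (fromℕ< x<n) ≡ d ∸ 1
  exceptional′ = Sum.map (trans degree-x) (trans degree-x) exceptional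
  regular′ : ∀ u → u ≢ fromℕ< x<n → degree H u ≡ d
  regular′ u u≢x = trans (degree≡deg u)
    (regular (toℕ u) (toℕ<n u) λ u≡x → u≢x (toℕ-injective (trans u≡x (sym (toℕ-fromℕ< x<n)))))
  noC5 : ¬ HasInducedC5 H
  noC5 (f , f-inj , f-adj) = free record
    { embed = toℕ ∘ f ; embed-< = toℕ<n ∘ f ; embed-inj = f-inj ∘ toℕ-injective ; embed-adj = f-adj }

nearlyRegular⇒almostRegular : ∀ {m d d₀} → NearlyRegularC5Free (suc m) d d₀ →
                              d₀ ≡ suc d ⊎ d₀ ≡ d ∸ 1 → AlmostRegularC5Free (suc m) d
nearlyRegular⇒almostRegular (G , size≡ , free , deg₀ , reg) d₀-ok =
  subst (λ n → AlmostRegularC5Free n _) size≡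
    (toGraph G free (subst (0 <_) (sym size≡) z<s) (Sum.map (trans deg₀) (trans deg₀) d₀-ok) reg)

almostRegularC5Free-odd : ∀ N e → suc (2 * e) ≤ N + N → suc (2 * e) ≢ N →
                          AlmostRegularC5Free (suc (N + N)) (suc (2 * e))
almostRegularC5Free-odd N e d≤2N d≢N with <-cmp (suc (2 * e)) N
... | tri< d<N _ _ = nearlyRegular⇒almostRegular (nearlyRegular-below {N} {e} d<N) (inj₁ refl)
... | tri≈ _ d≡N _ = ⊥-elim (d≢N d≡N)
... | tri> _ _ N<d = nearlyRegular⇒almostRegular (nearlyRegular-above {N} {e} N<d d≤2N) (inj₂ refl)

≡3-mod-4⇒odd : ∀ {n} → n % 4 ≡ 3 → ∃[ N ] n ≡ suc (N + N)
≡3-mod-4⇒odd {n} n%4≡3 = suc (2 * (n / 4)) ,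
  trans (m≡m%n+[m/n]*n n 4) (trans (cong (_+ n / 4 * 4) n%4≡3) (rearrange (n / 4)))
  where
  rearrange : ∀ q → 3 + q * 4 ≡ suc (suc (2 * q) + suc (2 * q))
  rearrange = solve-∀

≡1-mod-2⇒odd : ∀ {d} → d % 2 ≡ 1 → ∃[ e ] d ≡ suc (2 * e)
≡1-mod-2⇒odd {d} d%2≡1 = d / 2 ,
  trans (m≡m%n+[m/n]*n d 2) (trans (cong (_+ d / 2 * 2) d%2≡1) (cong suc (*-comm (d / 2) 2)))

lemma9 : ∀ (n d : ℕ) → n % 4 ≡ 3 → d % 2 ≡ 1 → 1 ≤ d → d ≤ n ∸ 1 →
    2 * d ≢ n ∸ 1 →
    ∃[ G ] (AlmostRegular {n} d G × ¬ HasInducedC5 G)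
lemma9 n d n%4≡3 d%2≡1 _ d≤2N 2d≢2N
  with N , refl ← ≡3-mod-4⇒odd {n} n%4≡3 | e , refl ← ≡1-mod-2⇒odd {d} d%2≡1 =
  almostRegularC5Free-odd N e d≤2N λ d≡N → 2d≢2N (trans (cong (2 *_) d≡N) (2*≡+ N))
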